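{- For all integers $m$ and $k$, \[F_{2m-2k+2}F_{k+1}F_{k-2}-F_{2k}F_{m-k-1}F_{m-k+2}=(-1)^{k+1}F_{m-2k+1}(F_{m+2}+F_{k-1}F_{m-k}).\]
   Context: $F_p$ denotes the $p$th Fibonacci number ($F_0=0$, $F_1=1$, $F_{p+1}=F_p+F_{p-1}$), extended to negative indices by $F_{ -r}=(-1)^{r+1}F_r$. -}

module Defs where

open import Data.Nat using (ℕ; zero; suc)
import Data.Nat as ℕ
open import Data.Integer using (ℤ; +_; -[1+_]; -_)

fib : ℕ → ℕ
fib zero = 0
fib (suc zero) = 1
fib (suc (suc n)) = fib (suc n) ℕ.+ fib n

sgn : ℕ → ℤ
sgn zero = + 1
sgn (suc n) = - sgn n

-- Fibonacci numbers on ℤ: F_{-r} = (-1)^{r+1} F_r.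
-- For r = suc n, (-1)^{r+1} = (-1)^n.
F : ℤ → ℤ
F (+ n) = + fib n
F -[1+ n ] = sgn n Data.Integer.* (+ fib (suc n))

sgnℤ : ℤ → ℤ
sgnℤ (+ n) = sgn n
sgnℤ -[1+ n ] = sgn (suc n)

-- Put A = m - k.  By the addition formula
--   F (a + b) = F a · F (b + 1) + F (a - 1) · F b       (a, b ∈ ℤ)
-- and the reflection formula F (- a) = -(-1)^a · F a, every Fibonacci
-- number occurring in the identity is an explicit polynomial in the four
-- values x = F A, y = F (A - 1), u = F k, v = F (k - 1) and the sign
-- s = (-1)^k.  The identity then becomes a polynomial identity in
-- x, y, u, v, s which holds modulo s² = 1.
module Submission where

open import Data.Nat using (ℕ; zero; suc)
import Data.Nat.Properties as ℕ
open import Data.Integer using (ℤ; +_; -[1+_]; _+_; _-_; _*_; -_)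
open import Data.Integer.Properties using (neg-involutive; +-assoc; +-comm; +-identityˡ; *-comm; *-identityˡ)
open import Data.Integer.Tactic.RingSolver using (solve-∀)
open import Data.Product using (_×_; _,_; proj₁)
open import Relation.Binary.PropositionalEquality
open ≡-Reasoning

open import Defs

sgn-square : ∀ n → sgn n * sgn n ≡ + 1
sgn-square zero    = refl
sgn-square (suc n) = trans (neg-square (sgn n)) (sgn-square n)
  where
  neg-square : ∀ s → (- s) * (- s) ≡ s * s
  neg-square = solve-∀

sgnℤ-square : ∀ z → sgnℤ z * sgnℤ z ≡ + 1
sgnℤ-square (+ n)    = sgn-square n
sgnℤ-square -[1+ n ] = sgn-square (suc n)

sgnℤ-suc : ∀ z → sgnℤ (z + + 1) ≡ - sgnℤ z
sgnℤ-suc (+ n) rewrite ℕ.+-comm n 1 = refl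
sgnℤ-suc -[1+ zero ]  = refl
sgnℤ-suc -[1+ suc n ] = sym (neg-involutive (sgn (suc n)))

sgnℤ-pred : ∀ z → sgnℤ (z - + 1) ≡ - sgnℤ z
sgnℤ-pred z = begin
  sgnℤ (z - + 1)          ≡⟨ sym (neg-involutive _) ⟩
  - - sgnℤ (z - + 1)      ≡⟨ cong -_ (sym (sgnℤ-suc (z - + 1))) ⟩
  - sgnℤ (z - + 1 + + 1)  ≡⟨ cong (λ t → - sgnℤ t) (pred-suc z) ⟩
  - sgnℤ z                ∎
  where
  pred-suc : ∀ z → z - + 1 + + 1 ≡ z
  pred-suc = solve-∀

sgnℤ-pred-pred : ∀ z → sgnℤ (z - + 2) ≡ sgnℤ z
sgnℤ-pred-pred z = begin
  sgnℤ (z - + 2)        ≡⟨ cong sgnℤ (two-steps z) ⟩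
  sgnℤ (z - + 1 - + 1)  ≡⟨ sgnℤ-pred (z - + 1) ⟩
  - sgnℤ (z - + 1)      ≡⟨ cong -_ (sgnℤ-pred z) ⟩
  - - sgnℤ z            ≡⟨ neg-involutive _ ⟩
  sgnℤ z                ∎
  where
  two-steps : ∀ z → z - + 2 ≡ z - + 1 - + 1
  two-steps = solve-∀

Recurrent : (ℤ → ℤ) → Set
Recurrent G = ∀ n → G (n + + 2) ≡ G (n + + 1) + G n

recurrent-backwards : ∀ G → Recurrent G → ∀ n → G n ≡ G (n + + 2) - G (n + + 1)
recurrent-backwards G rec n = begin
  G n                              ≡⟨ cancel (G (n + + 1)) (G n) ⟩
  G (n + + 1) + G n - G (n + + 1)  ≡⟨ cong (_- G (n + + 1)) (sym (rec n)) ⟩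
  G (n + + 2) - G (n + + 1)        ∎
  where
  cancel : ∀ a b → b ≡ a + b - a
  cancel = solve-∀

-- Two recurrent sequences agreeing at 0 and 1 agree everywhere: propagate
-- agreement on consecutive pairs upwards and downwards from (0, 1).
recurrent-unique : ∀ G H → Recurrent G → Recurrent H →
                   G (+ 0) ≡ H (+ 0) → G (+ 1) ≡ H (+ 1) → ∀ n → G n ≡ H n
recurrent-unique G H recG recH at0 at1 n = proj₁ (agree n)
  where
  Agree : ℤ → Set
  Agree n = G n ≡ H n × G (n + + 1) ≡ H (n + + 1)

  two-steps : ∀ n → n + + 1 + + 1 ≡ n + + 2
  two-steps n = +-assoc n (+ 1) (+ 1)

  forward : ∀ n → Agree n → Agree (n + + 1)
  forward n (e₀ , e₁) = e₁ , (begin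
    G (n + + 1 + + 1)    ≡⟨ cong G (two-steps n) ⟩
    G (n + + 2)          ≡⟨ recG n ⟩
    G (n + + 1) + G n    ≡⟨ cong₂ _+_ e₁ e₀ ⟩
    H (n + + 1) + H n    ≡⟨ sym (recH n) ⟩
    H (n + + 2)          ≡⟨ cong H (sym (two-steps n)) ⟩
    H (n + + 1 + + 1)    ∎)

  backward : ∀ n → Agree (n + + 1) → Agree n
  backward n (e₁ , e₂) = (begin
    G n                          ≡⟨ recurrent-backwards G recG n ⟩
    G (n + + 2) - G (n + + 1)    ≡⟨ cong₂ _-_ (trans (cong G (sym (two-steps n)))
                                                     (trans e₂ (cong H (two-steps n)))) e₁ ⟩
    H (n + + 2) - H (n + + 1)    ≡⟨ sym (recurrent-backwards H recH n) ⟩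
    H n                          ∎) , e₁

  agree : ∀ n → Agree n
  agree (+ zero)      = at0 , at1
  agree (+ suc j)     = subst Agree (cong +_ (ℕ.+-comm j 1)) (forward (+ j) (agree (+ j)))
  agree -[1+ zero ]   = backward -[1+ zero ] (agree (+ 0))
  agree -[1+ suc j ]  = backward -[1+ suc j ] (agree -[1+ j ])

recurrent-shift : ∀ G → Recurrent G → ∀ c → Recurrent (λ n → G (n + c))
recurrent-shift G rec c n = begin
  G (n + + 2 + c)                  ≡⟨ cong G (swap n (+ 2) c) ⟩
  G (n + c + + 2)                  ≡⟨ rec (n + c) ⟩
  G (n + c + + 1) + G (n + c)      ≡⟨ cong (λ t → G t + G (n + c)) (sym (swap n (+ 1) c)) ⟩
  G (n + + 1 + c) + G (n + c)      ∎
  where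
  swap : ∀ a b c → a + b + c ≡ a + c + b
  swap = solve-∀

recurrent-combination : ∀ G H → Recurrent G → Recurrent H →
                        ∀ p q → Recurrent (λ n → p * G n + q * H n)
recurrent-combination G H recG recH p q n = begin
  p * G (n + + 2) + q * H (n + + 2)
    ≡⟨ cong₂ (λ a b → p * a + q * b) (recG n) (recH n) ⟩
  p * (G (n + + 1) + G n) + q * (H (n + + 1) + H n)
    ≡⟨ distribute p q (G (n + + 1)) (G n) (H (n + + 1)) (H n) ⟩
  p * G (n + + 1) + q * H (n + + 1) + (p * G n + q * H n)  ∎
  where
  distribute : ∀ p q a b c d → p * (a + b) + q * (c + d) ≡ p * a + q * c + (p * b + q * d)
  distribute = solve-∀

F-recurrent : Recurrent F
F-recurrent (+ n) rewrite ℕ.+-comm n 2 | ℕ.+-comm n 1 = refl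
F-recurrent -[1+ zero ]        = refl
F-recurrent -[1+ suc zero ]    = refl
F-recurrent -[1+ suc (suc n) ] = alternate (sgn n) (+ fib (suc n)) (+ fib n)
  where
  -- with s = (-1)^n: F (-n-1) = s F (n+1), F (-n-2) = -s F (n+2), F (-n-3) = s F (n+3)
  alternate : ∀ s a b → s * a ≡ (- s) * (a + b) + (- (- s)) * (a + b + a)
  alternate = solve-∀

F-recurrent-at : ∀ {n n+1 n+2} → n+1 ≡ n + + 1 → n+2 ≡ n + + 2 → F n+2 ≡ F n+1 + F n
F-recurrent-at {n} refl refl = F-recurrent n

-- Addition formula: both sides are recurrent in b and agree at b = 0, 1.
F-add : ∀ a b → F (a + b) ≡ F a * F (b + + 1) + F (a - + 1) * F b
F-add a b = begin
  F (a + b)  ≡⟨ cong F (+-comm a b) ⟩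
  F (b + a)  ≡⟨ recurrent-unique (λ b → F (b + a))
                  (λ b → F a * F (b + + 1) + F (a - + 1) * F b)
                  (recurrent-shift F F-recurrent a)
                  (recurrent-combination (λ b → F (b + + 1)) F
                     (recurrent-shift F F-recurrent (+ 1)) F-recurrent (F a) (F (a - + 1)))
                  at0 at1 b ⟩
  F a * F (b + + 1) + F (a - + 1) * F b  ∎
  where
  at0 : F (+ 0 + a) ≡ F a * + 1 + F (a - + 1) * + 0
  at0 = trans (cong F (+-identityˡ a)) (unit (F a) (F (a - + 1)))
    where
    unit : ∀ x y → x ≡ x * + 1 + y * + 0
    unit = solve-∀
  at1 : F (+ 1 + a) ≡ F a * + 1 + F (a - + 1) * + 1
  at1 = trans (F-recurrent-at {n = a - + 1} (shift₁ a) (shift₂ a)) (unit (F a) (F (a - + 1)))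
    where
    shift₁ : ∀ a → a ≡ a - + 1 + + 1
    shift₁ = solve-∀
    shift₂ : ∀ a → + 1 + a ≡ a - + 1 + + 2
    shift₂ = solve-∀
    unit : ∀ x y → x + y ≡ x * + 1 + y * + 1
    unit = solve-∀

F-add-at : ∀ {c d} a b → c ≡ a + b → d ≡ b + + 1 → F c ≡ F a * F d + F (a - + 1) * F b
F-add-at a b refl refl = F-add a b

F-shift : ∀ a n → F (a + + n) ≡ + fib (suc n) * F a + + fib n * F (a - + 1)
F-shift a n = begin
  F (a + + n)
    ≡⟨ F-add a (+ n) ⟩
  F a * F (+ n + + 1) + F (a - + 1) * + fib n
    ≡⟨ cong (λ t → F a * F (+ t) + F (a - + 1) * + fib n) (ℕ.+-comm n 1) ⟩
  F a * + fib (suc n) + F (a - + 1) * + fib n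
    ≡⟨ cong₂ _+_ (*-comm (F a) _) (*-comm (F (a - + 1)) _) ⟩
  + fib (suc n) * F a + + fib n * F (a - + 1)  ∎

F-pred-pred : ∀ a → F (a - + 2) ≡ F a - F (a - + 1)
F-pred-pred a = begin
  F (a - + 2)                               ≡⟨ recurrent-backwards F F-recurrent (a - + 2) ⟩
  F (a - + 2 + + 2) - F (a - + 2 + + 1)     ≡⟨ cong₂ (λ p q → F p - F q) (up₂ a) (up₁ a) ⟩
  F a - F (a - + 1)                         ∎
  where
  up₂ : ∀ a → a - + 2 + + 2 ≡ a
  up₂ = solve-∀
  up₁ : ∀ a → a - + 2 + + 1 ≡ a - + 1
  up₁ = solve-∀

F-neg : ∀ z → F (- z) ≡ - sgnℤ z * F z
F-neg (+ zero)    = refl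
F-neg (+ suc n)   = cong (_* + fib (suc n)) (sym (neg-involutive (sgn n)))
F-neg -[1+ n ]    = begin
  + fib (suc n)                    ≡⟨ sym (*-identityˡ _) ⟩
  + 1 * + fib (suc n)              ≡⟨ cong (_* + fib (suc n)) (sym (sgn-square n)) ⟩
  sgn n * sgn n * + fib (suc n)    ≡⟨ regroup (sgn n) (+ fib (suc n)) ⟩
  - (- sgn n) * (sgn n * + fib (suc n))  ∎
  where
  regroup : ∀ s f → s * s * f ≡ - (- s) * (s * f)
  regroup = solve-∀

-- The polynomial shadow of Lemma 3.5: with x = F A, y = F (A - 1),
-- u = F k, v = F (k - 1) and s = (-1)^k, both sides agree once s² = 1.
-- The left side equals P = (x (u - v) - y v) · (F (m + 2) + v x) and the
-- right side equals s² · P.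
lemma3p5-core : ∀ x y u v s → s * s ≡ + 1 →
  (x * (+ 3 * x + + 2 * y) + y * (+ 2 * x + + 1 * y)) * (+ 1 * u + + 1 * v) * (u - v)
    - (u * (+ 1 * u + + 1 * v) + v * u) * y * (+ 2 * x + + 1 * y)
    ≡ - s * (x * (- s * (u - v)) + y * (- - s * v))
        * (x * (+ 3 * u + + 2 * v) + y * (+ 2 * u + + 1 * v) + v * x)
lemma3p5-core x y u v s s²≡1 = begin
  _                 ≡⟨ left x y u v ⟩
  common            ≡⟨ sym (*-identityˡ common) ⟩
  + 1 * common      ≡⟨ cong (_* common) (sym s²≡1) ⟩
  s * s * common    ≡⟨ right x y u v s ⟩
  _                 ∎
  where
  common : ℤ
  common = (x * (u - v) - y * v) * (x * (+ 3 * u + + 2 * v) + y * (+ 2 * u + + 1 * v) + v * x)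
  left : ∀ x y u v →
    (x * (+ 3 * x + + 2 * y) + y * (+ 2 * x + + 1 * y)) * (+ 1 * u + + 1 * v) * (u - v)
      - (u * (+ 1 * u + + 1 * v) + v * u) * y * (+ 2 * x + + 1 * y)
      ≡ (x * (u - v) - y * v) * (x * (+ 3 * u + + 2 * v) + y * (+ 2 * u + + 1 * v) + v * x)
  left = solve-∀
  right : ∀ x y u v s →
    s * s * ((x * (u - v) - y * v) * (x * (+ 3 * u + + 2 * v) + y * (+ 2 * u + + 1 * v) + v * x))
      ≡ - s * (x * (- s * (u - v)) + y * (- - s * v))
          * (x * (+ 3 * u + + 2 * v) + y * (+ 2 * u + + 1 * v) + v * x)
  right = solve-∀

lemma3p5 : ∀ (m k : ℤ) →
    F (+ 2 * m - + 2 * k + + 2) * F (k + + 1) * F (k - + 2)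
    - F (+ 2 * k) * F (m - k - + 1) * F (m - k + + 2)
    ≡ sgnℤ (k + + 1) * F (m - + 2 * k + + 1) * (F (m + + 2) + F (k - + 1) * F (m - k))
lemma3p5 m k = begin
  F (+ 2 * m - + 2 * k + + 2) * F (k + + 1) * F (k - + 2)
    - F (+ 2 * k) * F (m - k - + 1) * F (m - k + + 2)
      ≡⟨ cong₂ _-_ (cong₂ _*_ (cong₂ _*_ F[2A+2] (F-shift k 1)) (F-pred-pred k))
                   (cong₂ _*_ (cong (_* y) F[2k]) (F-shift A 2)) ⟩
  _   ≡⟨ lemma3p5-core x y u v s (sgnℤ-square k) ⟩
  _   ≡⟨ sym (cong₂ _*_ (cong₂ _*_ (sgnℤ-suc k) F[A-k+1]) (cong (_+ v * x) F[A+k+2])) ⟩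
  sgnℤ (k + + 1) * F (m - + 2 * k + + 1) * (F (m + + 2) + F (k - + 1) * F (m - k))  ∎
  where
  double-split : ∀ m k → + 2 * m - + 2 * k + + 2 ≡ (m - k) + (m - k + + 2)
  double-split = solve-∀
  twice : ∀ k → + 2 * k ≡ k + k
  twice = solve-∀
  sum-split : ∀ m k → m + + 2 ≡ (m - k) + (k + + 2)
  sum-split = solve-∀
  difference-split : ∀ m k → m - + 2 * k + + 1 ≡ (m - k) + - (k - + 1)
  difference-split = solve-∀
  reflect-suc : ∀ k → - (k - + 2) ≡ - (k - + 1) + + 1
  reflect-suc = solve-∀

  A = m - k
  x = F A
  y = F (A - + 1)
  u = F k
  v = F (k - + 1)
  s = sgnℤ k

  F[2A+2] : F (+ 2 * m - + 2 * k + + 2) ≡ x * (+ 3 * x + + 2 * y) + y * (+ 2 * x + + 1 * y)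
  F[2A+2] = trans (F-add-at A (A + + 2) (double-split m k) (sym (+-assoc A (+ 2) (+ 1))))
                  (cong₂ _+_ (cong (x *_) (F-shift A 3)) (cong (y *_) (F-shift A 2)))

  F[2k] : F (+ 2 * k) ≡ u * (+ 1 * u + + 1 * v) + v * u
  F[2k] = trans (F-add-at k k (twice k) refl) (cong (λ t → u * t + v * u) (F-shift k 1))

  F[A+k+2] : F (m + + 2) ≡ x * (+ 3 * u + + 2 * v) + y * (+ 2 * u + + 1 * v)
  F[A+k+2] = trans (F-add-at A (k + + 2) (sum-split m k) (sym (+-assoc k (+ 2) (+ 1))))
                   (cong₂ _+_ (cong (x *_) (F-shift k 3)) (cong (y *_) (F-shift k 2)))

  F[A-k+1] : F (m - + 2 * k + + 1) ≡ x * (- s * (u - v)) + y * (- - s * v)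
  F[A-k+1] = begin
    F (m - + 2 * k + + 1)
      ≡⟨ F-add-at A (- (k - + 1)) (difference-split m k) (reflect-suc k) ⟩
    x * F (- (k - + 2)) + y * F (- (k - + 1))
      ≡⟨ cong₂ (λ p q → x * p + y * q) (F-neg (k - + 2)) (F-neg (k - + 1)) ⟩
    x * (- sgnℤ (k - + 2) * F (k - + 2)) + y * (- sgnℤ (k - + 1) * v)
      ≡⟨ cong₂ (λ p q → x * (- p * F (k - + 2)) + y * (- q * v))
               (sgnℤ-pred-pred k) (sgnℤ-pred k) ⟩
    x * (- s * F (k - + 2)) + y * (- - s * v)
      ≡⟨ cong (λ t → x * (- s * t) + y * (- - s * v)) (F-pred-pred k) ⟩
    x * (- s * (u - v)) + y * (- - s * v)  ∎
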